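{- Let $n\ge 1$. (1) Suppose $1\le j<i\le n$ and let $v=(s_{n-1}s_{n-2}\cdots s_{j+1})(s_1s_2\cdots s_{i-1})$ (a product of simple transpositions; an empty product is the identity). (a) If $i=j+1$, then $v\cdot e=(1,n)$ and $\ell_{(n)}(v\cdot e)=\ell(v)$. (b) If $i=j+2$, then $v\cdot e=(1,n)$ and $\ell_{(n)}(v\cdot e)=\ell(v)-1$. (c) If $i>j+2$, then $v\cdot e=(1,n)(j+1,i-1)$ and $\ell_{(n)}(v\cdot e)=\ell(v)-1$. (2) Suppose $1\le i<j\le n$ and let $v=(s_{n-1}s_{n-2}\cdots s_j)(s_1s_2\cdots s_{i-1})$. Then $v\cdot e=(1,i)(j,n)$ and $\ell_{(n)}(v\cdot e)=\ell(v)$. Here $v\cdot e$ is computed by letting the displayed letters act on $e$ one at a time, rightmost letter first.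
   Context: $\mathrm{S}_n$ is the symmetric group on $[n]=\{1,\dots,n\}$; permutations are written in one-line notation $[w(1)\cdots w(n)]$ or in cycle notation with parentheses (a cycle $(a,a)$ is the identity). Products are compositions, $(uv)(x)=u(v(x))$. $s_k=(k,k+1)$ for $1\le k\le n-1$. $\mathrm{I}_n$ is the set of involutions in $\mathrm{S}_n$ and $e$ is the identity. $\ell(w)$ is the number of inversions of $w$, $\mathrm{exc}(w)=\#\{a:w(a)>a\}$, and $\ell_{(n)}(\pi)=\frac{\ell(\pi)+\mathrm{exc}(\pi)}{2}$ for $\pi\in\mathrm{I}_n$. For $\pi\in\mathrm{I}_n$ and $1\le k\le n-1$: $s_k\cdot\pi=\pi$ if $\pi^{ -1}(k+1)<\pi^{ -1}(k)$; $s_k\cdot\pi=s_k\pi$ if $\pi(k)=k$ and $\pi(k+1)=k+1$; $s_k\cdot\pi=s_k\pi s_k$ otherwise. For a word $s_{k_1}s_{k_2}\cdots s_{k_m}$, its action is $s_{k_1}\cdot(s_{k_2}\cdot(\cdots(s_{k_m}\cdot\pi)))$. -}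

module Defs where

open import Data.Nat using (ℕ; zero; suc; _+_; _∸_; _<ᵇ_; _≡ᵇ_; _/_; _≤_)
open import Data.Bool using (Bool; true; false; if_then_else_; _∧_)
open import Data.List using (List; []; _∷_; foldr; reverse; _++_)
open import Relation.Binary.PropositionalEquality using (_≡_)

-- A permutation of [n] is represented as a function ℕ → ℕ; only its values
-- on 1..n matter (all permutations below fix every point outside [n]).
Perm : Set
Perm = ℕ → ℕ

e : Perm
e x = x

_·ₚ_ : Perm → Perm → Perm
(u ·ₚ v) x = u (v x)

tr : ℕ → ℕ → Perm
tr a b x = if x ≡ᵇ a then b else (if x ≡ᵇ b then a else x)

s : ℕ → Perm
s k = tr k (suc k)

_≈[_]_ : Perm → ℕ → Perm → Set
u ≈[ n ] w = ∀ x → 1 ≤ x → x ≤ n → u x ≡ w x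

asc : ℕ → ℕ → List ℕ
asc a zero    = []
asc a (suc m) = a ∷ asc (suc a) m

-- the word s_lo s_{lo+1} ... s_hi as a list of indices (empty if hi < lo)
ascWord : ℕ → ℕ → List ℕ
ascWord lo hi = asc lo (suc hi ∸ lo)

descWord : ℕ → ℕ → List ℕ
descWord hi lo = reverse (ascWord lo hi)

wordPerm : List ℕ → Perm
wordPerm []       = e
wordPerm (k ∷ ks) = s k ·ₚ wordPerm ks

-- π⁻¹(x) in S_n: the a ∈ [n] with π a = x (search from n down to 1; default x)
invSearch : ℕ → Perm → ℕ → ℕ
invSearch zero    π x = x
invSearch (suc a) π x = if π (suc a) ≡ᵇ x then suc a else invSearch a π x

inv : ℕ → Perm → Perm
inv n π x = invSearch n π x

act : ℕ → ℕ → Perm → Perm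
act n k π =
  if inv n π (suc k) <ᵇ inv n π k then π
  else (if (π k ≡ᵇ k) ∧ (π (suc k) ≡ᵇ suc k) then s k ·ₚ π
        else (s k ·ₚ π) ·ₚ s k)

actWord : ℕ → List ℕ → Perm → Perm
actWord n ks π = foldr (act n) π ks

countUpTo : ℕ → (ℕ → Bool) → ℕ
countUpTo zero    p = 0
countUpTo (suc m) p = (if p (suc m) then 1 else 0) + countUpTo m p

inversions : ℕ → Perm → ℕ
inversions n w = go n
  where
  go : ℕ → ℕ
  go zero    = 0
  go (suc b) = countUpTo b (λ a → w (suc b) <ᵇ w a) + go b

exc : ℕ → Perm → ℕ
exc n w = countUpTo n (λ a → a <ᵇ w a)

ℓI : ℕ → Perm → ℕ
ℓI n π = (inversions n π + exc n π) / 2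

vWord₁ : ℕ → ℕ → ℕ → List ℕ
vWord₁ n i j = descWord (n ∸ 1) (suc j) ++ ascWord 1 (i ∸ 1)

vWord₂ : ℕ → ℕ → ℕ → List ℕ
vWord₂ n i j = descWord (n ∸ 1) j ++ ascWord 1 (i ∸ 1)

-- A letter s_k acting on an involution π either leaves it unchanged (a descent: k+1
-- precedes k in π⁻¹) or replaces it by s_k π or s_k π s_k, and in the latter two cases
-- ℓ(π) + exc(π) grows by exactly 2.  Acting on e, the letters s_{i-1}, …, s_1 build the
-- cycle (1,i) one ascent at a time; each descending letter s_d, …, s_{n-1} then opens the
-- cycle (d,d+1) or moves an endpoint of a 2-cycle from d to d+1, again an ascent, except
-- in part (1) with i ≥ j+2, where s_{i-1} meets the descent of (j+1,i-1)(1,i) at i-1.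
-- So 2ℓ_(n)(v·e) is twice the number of letters of v, less 2 for that descent.  On the
-- other side every letter of v adds one inversion when v is multiplied out, so ℓ(v) is
-- the number of letters.

module Submission where

open import Defs
open import Data.Nat
open import Data.Nat.Properties
open import Data.Nat.DivMod using (m*n/n≡m)
open import Data.Nat.Tactic.RingSolver using (solve-∀)
open import Algebra.Properties.CommutativeSemigroup +-commutativeSemigroup using (x∙yz≈y∙xz; interchange)
open import Data.Bool using (Bool; true; false; if_then_else_; _∧_; T)
open import Data.Bool.Properties using (T-≡)
open import Data.List using ([]; _∷_; foldr; foldl; reverse; _++_)
open import Data.List.Properties using (reverse-foldr; foldr-++; foldl-++)
open import Data.Product using (_×_; _,_; proj₁; proj₂; Σ-syntax; map₁)
open import Data.Sum using (_⊎_; inj₁; inj₂)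
open import Data.Empty using (⊥-elim)
open import Function using (_∘_; flip)
open import Function.Bundles using (Equivalence)
open import Function.Definitions using (Injective)
open import Relation.Nullary using (¬_; Dec; yes; no)
open import Relation.Binary.PropositionalEquality

≡ᵇ-refl : ∀ x → (x ≡ᵇ x) ≡ true
≡ᵇ-refl x = Equivalence.to T-≡ (≡⇒≡ᵇ x x refl)

≡ᵇ-true⇒≡ : ∀ {x y} → (x ≡ᵇ y) ≡ true → x ≡ y
≡ᵇ-true⇒≡ {x} {y} eq = ≡ᵇ⇒≡ x y (Equivalence.from T-≡ eq)

≢⇒≡ᵇ-false : ∀ {x y} → x ≢ y → (x ≡ᵇ y) ≡ false
≢⇒≡ᵇ-false {x} {y} x≢y with x ≡ᵇ y in eq
... | false = refl
... | true  = ⊥-elim (x≢y (≡ᵇ-true⇒≡ eq))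

<⇒<ᵇ-true : ∀ {x y} → x < y → (x <ᵇ y) ≡ true
<⇒<ᵇ-true x<y = Equivalence.to T-≡ (<⇒<ᵇ x<y)

<ᵇ-true⇒< : ∀ {x y} → (x <ᵇ y) ≡ true → x < y
<ᵇ-true⇒< {x} {y} eq = <ᵇ⇒< x y (Equivalence.from T-≡ eq)

≤⇒<ᵇ-false : ∀ {x y} → y ≤ x → (x <ᵇ y) ≡ false
≤⇒<ᵇ-false {x} {y} y≤x with x <ᵇ y in eq
... | false = refl
... | true  = ⊥-elim (<⇒≱ (<ᵇ-true⇒< eq) y≤x)

<ᵇ-false⇒≤ : ∀ {x y} → (x <ᵇ y) ≡ false → y ≤ x
<ᵇ-false⇒≤ eq = ≮⇒≥ (λ x<y → subst T eq (<⇒<ᵇ x<y))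

<ᵇ-irrefl : ∀ x → (x <ᵇ x) ≡ false
<ᵇ-irrefl x = ≤⇒<ᵇ-false {x} ≤-refl

<ᵇ-cong-⇔ : ∀ {x y x′ y′} → (x < y → x′ < y′) → (x′ < y′ → x < y) →
            (x <ᵇ y) ≡ (x′ <ᵇ y′)
<ᵇ-cong-⇔ {x} {y} {x′} {y′} to from with x <ᵇ y in eq
... | true = sym (<⇒<ᵇ-true (to (<ᵇ-true⇒< eq)))
... | false with x′ <ᵇ y′ in eq′
...   | true  = ⊥-elim (<⇒≱ (from (<ᵇ-true⇒< eq′)) (<ᵇ-false⇒≤ eq))
...   | false = refl

tr-fst : ∀ a b → tr a b a ≡ b
tr-fst a b rewrite ≡ᵇ-refl a = refl

tr-snd : ∀ a b → tr a b b ≡ a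
tr-snd a b with b ≡ᵇ a in eq
... | true  = ≡ᵇ-true⇒≡ eq
... | false rewrite ≡ᵇ-refl b = refl

tr-other : ∀ {a b x} → x ≢ a → x ≢ b → tr a b x ≡ x
tr-other x≢a x≢b rewrite ≢⇒≡ᵇ-false x≢a | ≢⇒≡ᵇ-false x≢b = refl

tr-diag : ∀ a x → tr a a x ≡ x
tr-diag a x with x ≟ a
... | yes refl = tr-fst x x
... | no x≢a   = tr-other x≢a x≢a

tr-involutive : ∀ a b x → tr a b (tr a b x) ≡ x
tr-involutive a b x with x ≟ a
... | yes refl rewrite tr-fst x b = tr-snd x b
... | no x≢a with x ≟ b
...   | yes refl rewrite tr-snd a x = tr-fst a x
...   | no x≢b rewrite tr-other x≢a x≢b = tr-other x≢a x≢b

tr-conj : ∀ (σ : Perm) → (∀ x → σ (σ x) ≡ x) → ∀ a b x → σ (tr a b (σ x)) ≡ tr (σ a) (σ b) x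
tr-conj σ σσ a b x with x ≟ σ a
... | yes refl rewrite σσ a | tr-fst a b = sym (tr-fst (σ a) (σ b))
... | no x≢σa with x ≟ σ b
...   | yes refl rewrite σσ b | tr-snd a b = sym (tr-snd (σ a) (σ b))
...   | no x≢σb = begin
  σ (tr a b (σ x)) ≡⟨ cong σ (tr-other (x≢σa ∘ σ-flip) (x≢σb ∘ σ-flip)) ⟩
  σ (σ x)          ≡⟨ σσ x ⟩
  x                ≡⟨ tr-other x≢σa x≢σb ⟨
  tr (σ a) (σ b) x ∎
  where
  open ≡-Reasoning
  σ-flip : ∀ {y} → σ x ≡ y → x ≡ σ y
  σ-flip eq = trans (sym (σσ x)) (cong σ eq)

s-involutive : ∀ k x → s k (s k x) ≡ x
s-involutive k = tr-involutive k (suc k)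

s-other : ∀ {k x} → x ≢ k → x ≢ suc k → s k x ≡ x
s-other = tr-other

s-below : ∀ {k x} → x < k → s k x ≡ x
s-below x<k = s-other (<⇒≢ x<k) (<⇒≢ (m<n⇒m<1+n x<k))

s-above : ∀ {k x} → suc k < x → s k x ≡ x
s-above 1+k<x = s-other (>⇒≢ (<-trans (n<1+n _) 1+k<x)) (>⇒≢ 1+k<x)

tr-conj-s : ∀ k a b x → ((s k ·ₚ tr a b) ·ₚ s k) x ≡ tr (s k a) (s k b) x
tr-conj-s k = tr-conj (s k) (s-involutive k)

tr₂ : ℕ → ℕ → ℕ → ℕ → Perm
tr₂ a b c d = tr a b ·ₚ tr c d

tr₂-conj-s : ∀ k a b c d x → s k (tr₂ a b c d (s k x)) ≡ tr₂ (s k a) (s k b) (s k c) (s k d) x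
tr₂-conj-s k a b c d x =
  trans (cong (s k ∘ tr a b) (sym (s-involutive k (tr c d (s k x)))))
        (trans (tr-conj-s k a b (s k (tr c d (s k x))))
               (cong (tr (s k a) (s k b)) (tr-conj-s k c d x)))

tr₂-comm : ∀ {a b c d} → c ≢ a → c ≢ b → d ≢ a → d ≢ b → ∀ x → tr₂ a b c d x ≡ tr₂ c d a b x
tr₂-comm {a} {b} {c} {d} c≢a c≢b d≢a d≢b x =
  trans (cong (tr a b ∘ tr c d) (sym (tr-involutive a b x)))
        (trans (tr-conj (tr a b) (tr-involutive a b) c d (tr a b x))
               (cong₂ (λ u v → tr u v (tr a b x)) (tr-other c≢a c≢b) (tr-other d≢a d≢b)))

s-bounded : ∀ {n k x} → 1 ≤ k → suc k ≤ n → 1 ≤ x → x ≤ n → 1 ≤ s k x × s k x ≤ n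
s-bounded {n} {k} {x} 1≤k 1+k≤n 1≤x x≤n with x ≟ k | x ≟ suc k
... | yes refl | _        rewrite tr-fst x (suc x) = s≤s z≤n , 1+k≤n
... | no _     | yes refl rewrite tr-snd k (suc k) = 1≤k , ≤-trans (n≤1+n k) 1+k≤n
... | no x≢k   | no x≢1+k rewrite s-other x≢k x≢1+k = 1≤x , x≤n

s-preserves-<ᵇ : ∀ k x y → ¬ (x ≡ k × y ≡ suc k) → ¬ (x ≡ suc k × y ≡ k) →
                 (s k y <ᵇ s k x) ≡ (y <ᵇ x)
s-preserves-<ᵇ k x y kk′ k′k with x ≟ k | x ≟ suc k | y ≟ k | y ≟ suc k
... | yes refl | _ | yes refl | _ = trans (<ᵇ-irrefl (s x x)) (sym (<ᵇ-irrefl x))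
... | yes refl | _ | no _ | yes refl = ⊥-elim (kk′ (refl , refl))
... | yes refl | _ | no y≢k | no y≢1+k rewrite tr-fst x (suc x) | s-other y≢k y≢1+k =
  <ᵇ-cong-⇔ (λ y<1+x → ≤∧≢⇒< (≤-pred y<1+x) y≢k) m<n⇒m<1+n
... | no _ | yes refl | yes refl | _ = ⊥-elim (k′k (refl , refl))
... | no _ | yes refl | no _ | yes refl = trans (<ᵇ-irrefl (s k y)) (sym (<ᵇ-irrefl y))
... | no _ | yes refl | no y≢k | no y≢1+k rewrite tr-snd k (suc k) | s-other y≢k y≢1+k =
  <ᵇ-cong-⇔ m<n⇒m<1+n (λ y<1+k → ≤∧≢⇒< (≤-pred y<1+k) y≢k)
... | no x≢k | no x≢1+k | yes refl | _ rewrite tr-fst y (suc y) | s-other x≢k x≢1+k =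
  <ᵇ-cong-⇔ (<-trans (n<1+n y)) (λ y<x → ≤∧≢⇒< y<x (x≢1+k ∘ sym))
... | no x≢k | no x≢1+k | no _ | yes refl rewrite tr-snd k (suc k) | s-other x≢k x≢1+k =
  <ᵇ-cong-⇔ (λ k<x → ≤∧≢⇒< k<x (x≢1+k ∘ sym)) (<-trans (n<1+n k))
... | no x≢k | no x≢1+k | no y≢k | no y≢1+k rewrite s-other x≢k x≢1+k | s-other y≢k y≢1+k = refl

s-swaps-<ᵇ : ∀ k a y → (a ≡ k → y ≢ k) → (a ≡ suc k → y ≢ suc k) → (a <ᵇ s k y) ≡ (s k a <ᵇ y)
s-swaps-<ᵇ k a y k-case 1+k-case =
  trans (sym (s-preserves-<ᵇ k (s k y) a kk′ k′k)) (cong (s k a <ᵇ_) (s-involutive k y))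
  where
  s-flip : ∀ {z} → s k y ≡ z → y ≡ s k z
  s-flip eq = trans (sym (s-involutive k y)) (cong (s k) eq)
  kk′ : ¬ (s k y ≡ k × a ≡ suc k)
  kk′ (sy≡k , a≡1+k) = 1+k-case a≡1+k (trans (s-flip sy≡k) (tr-fst k (suc k)))
  k′k : ¬ (s k y ≡ suc k × a ≡ k)
  k′k (sy≡1+k , a≡k) = k-case a≡k (trans (s-flip sy≡1+k) (tr-snd k (suc k)))

s-mono-< : ∀ k {x y} → x < y → ¬ (x ≡ k × y ≡ suc k) → s k x < s k y
s-mono-< k {x} {y} x<y not-kk′ =
  <ᵇ-true⇒< (trans (s-preserves-<ᵇ k y x k′k (λ (x≡1+k , y≡k) → not-kk′ (y≡k , x≡1+k)))
                   (<⇒<ᵇ-true x<y))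
  where
  k′k : ¬ (y ≡ k × x ≡ suc k)
  k′k (refl , refl) = <-asym x<y (n<1+n y)

-- Inversions and excedances
indicator : Bool → ℕ
indicator b = if b then 1 else 0

countUpTo-cong : ∀ m {f g : ℕ → Bool} → (∀ a → 1 ≤ a → a ≤ m → f a ≡ g a) →
                 countUpTo m f ≡ countUpTo m g
countUpTo-cong zero    f≗g = refl
countUpTo-cong (suc m) f≗g =
  cong₂ _+_ (cong indicator (f≗g (suc m) (s≤s z≤n) ≤-refl))
            (countUpTo-cong m (λ a 1≤a a≤m → f≗g a 1≤a (m≤n⇒m≤1+n a≤m)))

countUpTo-false : ∀ m → countUpTo m (λ _ → false) ≡ 0
countUpTo-false zero    = refl
countUpTo-false (suc m) = countUpTo-false m

countUpTo-one-more : ∀ m {f g : ℕ → Bool} p → 1 ≤ p → p ≤ m → f p ≡ true → g p ≡ false →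
                     (∀ a → 1 ≤ a → a ≤ m → a ≢ p → f a ≡ g a) →
                     countUpTo m f ≡ suc (countUpTo m g)
countUpTo-one-more zero    .zero () z≤n fp gp f≗g
countUpTo-one-more (suc m) {f} {g} p 1≤p p≤m fp gp f≗g with p ≟ suc m
... | yes refl rewrite fp | gp =
  cong suc (countUpTo-cong m (λ a 1≤a a≤m → f≗g a 1≤a (m≤n⇒m≤1+n a≤m) (<⇒≢ (s≤s a≤m))))
... | no p≢1+m
  rewrite f≗g (suc m) (s≤s z≤n) ≤-refl (p≢1+m ∘ sym)
        | countUpTo-one-more m p 1≤p (≤-pred (≤∧≢⇒< p≤m p≢1+m)) fp gp
            (λ a 1≤a a≤m → f≗g a 1≤a (m≤n⇒m≤1+n a≤m))
  = +-suc (indicator (g (suc m))) (countUpTo m g)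

countUpTo-s : ∀ k m (h : ℕ → Bool) → 1 ≤ k → suc k ≤ m →
              countUpTo m (h ∘ s k) ≡ countUpTo m h
countUpTo-s (suc k) (suc m) h 1≤k 2+k≤1+m with m ≟ suc k
... | yes refl =
  trans (cong₂ (λ x y → indicator (h x) + (indicator (h y) + countUpTo k (h ∘ s m)))
               (tr-snd m (suc m)) (tr-fst m (suc m)))
  (trans (cong (λ c → indicator (h m) + (indicator (h (suc m)) + c))
               (countUpTo-cong k (λ a _ a≤k → cong h (s-below (s≤s a≤k)))))
         (x∙yz≈y∙xz (indicator (h m)) (indicator (h (suc m))) (countUpTo k h)))
... | no m≢1+k =
  cong₂ _+_ (cong (indicator ∘ h) (s-above (s≤s 2+k≤m)))
            (countUpTo-s (suc k) m h 1≤k 2+k≤m)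
  where
  2+k≤m : suc (suc k) ≤ m
  2+k≤m = ≤∧≢⇒< (≤-pred 2+k≤1+m) (m≢1+k ∘ sym)

inversions-cong : ∀ m {u w : Perm} → u ≈[ m ] w → inversions m u ≡ inversions m w
inversions-cong zero    u≈w = refl
inversions-cong (suc m) u≈w =
  cong₂ _+_ (countUpTo-cong m (λ a 1≤a a≤m →
               cong₂ _<ᵇ_ (u≈w (suc m) (s≤s z≤n) ≤-refl) (u≈w a 1≤a (m≤n⇒m≤1+n a≤m))))
            (inversions-cong m (λ a 1≤a a≤m → u≈w a 1≤a (m≤n⇒m≤1+n a≤m)))

inversions-e : ∀ n → inversions n e ≡ 0
inversions-e zero    = refl
inversions-e (suc n) =
  cong₂ _+_ (trans (countUpTo-cong n (λ a _ a≤n → ≤⇒<ᵇ-false (m≤n⇒m≤1+n a≤n))) (countUpTo-false n))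
            (inversions-e n)

exc-e : ∀ n → exc n e ≡ 0
exc-e n = trans (countUpTo-cong n (λ a _ _ → <ᵇ-irrefl a)) (countUpTo-false n)

column : Perm → ℕ → ℕ
column w b = countUpTo b (λ a → w (suc b) <ᵇ w a)

inversions-left-s : ∀ n {w : Perm} {k p q} → Injective _≡_ _≡_ w → 1 ≤ p → p < q → q ≤ n →
                    w p ≡ k → w q ≡ suc k → inversions n (s k ·ₚ w) ≡ suc (inversions n w)
inversions-left-s n {w} {k} {p} {q} inj 1≤p p<q q≤n wp wq = above n q≤n
  where
  column-other : ∀ b → suc b ≢ q → column (s k ·ₚ w) b ≡ column w b
  column-other b 1+b≢q = countUpTo-cong b (λ a _ a≤b → s-preserves-<ᵇ k (w a) (w (suc b))
    (λ (_ , w[1+b]≡1+k) → 1+b≢q (inj (trans w[1+b]≡1+k (sym wq))))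
    (λ (wa≡1+k , w[1+b]≡k) → <-asym (subst₂ _<_ (inj (trans wa≡1+k (sym wq)))
                                                 (inj (trans w[1+b]≡k (sym wp))) (s≤s a≤b)) p<q))

  column-q : ∀ b → suc b ≡ q → column (s k ·ₚ w) b ≡ suc (column w b)
  column-q b refl = countUpTo-one-more b p 1≤p (≤-pred p<q)
    (trans (cong₂ _<ᵇ_ (trans (cong (s k) wq) (tr-snd k (suc k))) (trans (cong (s k) wp) (tr-fst k (suc k))))
           (<⇒<ᵇ-true (n<1+n k)))
    (trans (cong₂ _<ᵇ_ wq wp) (≤⇒<ᵇ-false (n≤1+n k)))
    (λ a _ a≤b a≢p → s-preserves-<ᵇ k (w a) (w (suc b))
       (λ (wa≡k , _) → a≢p (inj (trans wa≡k (sym wp))))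
       (λ (wa≡1+k , _) → <⇒≢ (s≤s a≤b) (inj (trans wa≡1+k (sym wq)))))

  below : ∀ m → m < q → inversions m (s k ·ₚ w) ≡ inversions m w
  below zero    _     = refl
  below (suc m) 1+m<q =
    cong₂ _+_ (column-other m (<⇒≢ 1+m<q)) (below m (<-trans (n<1+n m) 1+m<q))

  above : ∀ m → q ≤ m → inversions m (s k ·ₚ w) ≡ suc (inversions m w)
  above zero    q≤0 = ⊥-elim (<⇒≱ (<-≤-trans (s≤s z≤n) p<q) q≤0)
  above (suc m) q≤1+m with suc m ≟ q
  ... | yes 1+m≡q = cong₂ _+_ (column-q m 1+m≡q) (below m (subst (m <_) 1+m≡q ≤-refl))
  ... | no 1+m≢q =
    trans (cong₂ _+_ (column-other m 1+m≢q) (above m (≤-pred (≤∧≢⇒< q≤1+m (1+m≢q ∘ sym)))))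
          (+-suc _ _)

inversions-right-s : ∀ n (π : Perm) k → 1 ≤ k → suc k ≤ n → π k < π (suc k) →
                     inversions n (π ·ₚ s k) ≡ suc (inversions n π)
inversions-right-s (suc n) π (suc k) 1≤k 2+k≤1+n πk<πk′ with n ≟ suc k
... | yes refl = begin
  indicator (π (s n (suc n)) <ᵇ π (s n n)) + countUpTo k (λ a → π (s n (suc n)) <ᵇ π (s n a))
    + (countUpTo k (λ a → π (s n n) <ᵇ π (s n a)) + inversions k (π ·ₚ s n))
      ≡⟨ cong₂ _+_ (cong₂ _+_ head (countUpTo-cong k (λ a _ a≤k →
                     cong₂ _<ᵇ_ (cong π (tr-snd n (suc n))) (cong π (fixed a≤k)))))
                   (cong₂ _+_ (countUpTo-cong k (λ a _ a≤k →
                                 cong₂ _<ᵇ_ (cong π (tr-fst n (suc n))) (cong π (fixed a≤k))))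
                              (inversions-cong k (λ a _ a≤k → cong π (fixed a≤k)))) ⟩
  suc (A + (B + I)) ≡⟨ cong suc (x∙yz≈y∙xz A B I) ⟩
  suc (B + (A + I)) ≡⟨ cong (λ b → suc (indicator b + B + (A + I))) (≤⇒<ᵇ-false (<⇒≤ πk<πk′)) ⟨
  suc (indicator (π (suc n) <ᵇ π n) + B + (A + I)) ∎
  where
  open ≡-Reasoning
  A = countUpTo k (λ a → π n <ᵇ π a)
  B = countUpTo k (λ a → π (suc n) <ᵇ π a)
  I = inversions k π
  fixed : ∀ {a} → a ≤ k → s n a ≡ a
  fixed a≤k = s-below (s≤s a≤k)
  head : indicator (π (s n (suc n)) <ᵇ π (s n n)) ≡ 1
  head rewrite tr-snd n (suc n) | tr-fst n (suc n) | <⇒<ᵇ-true πk<πk′ = refl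
... | no n≢1+k =
  trans (cong₂ _+_ top-column (inversions-right-s n π (suc k) 1≤k 2+k≤n πk<πk′)) (+-suc _ _)
  where
  2+k≤n : suc (suc k) ≤ n
  2+k≤n = ≤∧≢⇒< (≤-pred 2+k≤1+n) (n≢1+k ∘ sym)
  top-column : column (π ·ₚ s (suc k)) n ≡ column π n
  top-column = trans (cong (λ z → countUpTo n (λ a → π z <ᵇ π (s (suc k) a))) (s-above (s≤s 2+k≤n)))
                     (countUpTo-s (suc k) n (λ a → π (suc n) <ᵇ π a) 1≤k 2+k≤n)

exc-left-s-fixed : ∀ n {π : Perm} k → Injective _≡_ _≡_ π → π k ≡ k → π (suc k) ≡ suc k →
                   1 ≤ k → suc k ≤ n → exc n (s k ·ₚ π) ≡ suc (exc n π)
exc-left-s-fixed n {π} k inj πk πk′ 1≤k 1+k≤n =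
  countUpTo-one-more n k 1≤k (≤-trans (n≤1+n k) 1+k≤n)
    (trans (cong (k <ᵇ_) (trans (cong (s k) πk) (tr-fst k (suc k)))) (<⇒<ᵇ-true (n<1+n k)))
    (trans (cong (k <ᵇ_) πk) (<ᵇ-irrefl k))
    others
  where
  others : ∀ a → 1 ≤ a → a ≤ n → a ≢ k → (a <ᵇ s k (π a)) ≡ (a <ᵇ π a)
  others a _ _ a≢k with a ≟ suc k
  ... | yes refl = trans (cong (suc k <ᵇ_) (trans (cong (s k) πk′) (tr-snd k (suc k))))
                         (trans (≤⇒<ᵇ-false (n≤1+n k))
                                (sym (trans (cong (suc k <ᵇ_) πk′) (<ᵇ-irrefl (suc k)))))
  ... | no a≢1+k = cong (a <ᵇ_) (s-other (a≢k ∘ inj ∘ flip trans (sym πk))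
                                         (a≢1+k ∘ inj ∘ flip trans (sym πk′)))

exc-conj-s : ∀ n (π : Perm) k → π (suc k) ≢ k → π k ≢ suc k → 1 ≤ k → suc k ≤ n →
             exc n ((s k ·ₚ π) ·ₚ s k) ≡ exc n π
exc-conj-s n π k πk′≢k πk≢k′ 1≤k 1+k≤n =
  trans (countUpTo-cong n (λ a _ _ → s-swaps-<ᵇ k a (π (s k a)) k-case 1+k-case))
        (countUpTo-s k n (λ a → a <ᵇ π a) 1≤k 1+k≤n)
  where
  k-case : ∀ {a} → a ≡ k → π (s k a) ≢ k
  k-case refl = subst (λ z → π z ≢ k) (sym (tr-fst k (suc k))) πk′≢k
  1+k-case : ∀ {a} → a ≡ suc k → π (s k a) ≢ suc k
  1+k-case refl = subst (λ z → π z ≢ suc k) (sym (tr-snd k (suc k))) πk≢k′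

-- The action of simple transpositions on involutions
record IsInvolution (n : ℕ) (π : Perm) : Set where
  field
    involutive : ∀ x → π (π x) ≡ x
    bounded    : ∀ {x} → 1 ≤ x → x ≤ n → 1 ≤ π x × π x ≤ n

  injective : Injective _≡_ _≡_ π
  injective {x} {y} πx≡πy = trans (sym (involutive x)) (trans (cong π πx≡πy) (involutive y))

open IsInvolution

invSearch-involution : ∀ {π : Perm} → (∀ x → π (π x) ≡ x) →
                       ∀ m {x y} → π y ≡ x → 1 ≤ y → y ≤ m → invSearch m π x ≡ y
invSearch-involution ππ zero    _ 1≤y y≤0 = ⊥-elim (<⇒≱ 1≤y y≤0)
invSearch-involution {π} ππ (suc m) {x} {y} πy≡x 1≤y y≤1+m with π (suc m) ≡ᵇ x in eq
... | true  = trans (sym (ππ (suc m))) (trans (cong π (trans (≡ᵇ-true⇒≡ eq) (sym πy≡x))) (ππ y))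
... | false = invSearch-involution ππ m πy≡x 1≤y (≤-pred (≤∧≢⇒< y≤1+m y≢1+m))
  where
  y≢1+m : y ≢ suc m
  y≢1+m refl with trans (sym eq) (subst (λ z → (z ≡ᵇ x) ≡ true) (sym πy≡x) (≡ᵇ-refl x))
  ... | ()

inv-involution : ∀ {n π} → IsInvolution n π → ∀ {x} → 1 ≤ x → x ≤ n → inv n π x ≡ π x
inv-involution {n} {π} π-inv 1≤x x≤n =
  invSearch-involution (involutive π-inv) n (involutive π-inv _) (proj₁ (bounded π-inv 1≤x x≤n))
                       (proj₂ (bounded π-inv 1≤x x≤n))

module Action {n : ℕ} {π : Perm} (π-inv : IsInvolution n π) {k : ℕ} (1≤k : 1 ≤ k) (1+k≤n : suc k ≤ n) where

  private
    choose : Bool → Bool → Perm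
    choose descent fixed = if descent then π else (if fixed then s k ·ₚ π else (s k ·ₚ π) ·ₚ s k)

    act-unfold : act n k π ≡ choose (π (suc k) <ᵇ π k) ((π k ≡ᵇ k) ∧ (π (suc k) ≡ᵇ suc k))
    act-unfold = cong₂ (λ u v → choose (u <ᵇ v) ((π k ≡ᵇ k) ∧ (π (suc k) ≡ᵇ suc k)))
                       (inv-involution π-inv (s≤s z≤n) 1+k≤n)
                       (inv-involution π-inv 1≤k (≤-trans (n≤1+n k) 1+k≤n))

  act-descent : π (suc k) < π k → act n k π ≡ π
  act-descent πk′<πk =
    trans act-unfold (cong (λ b → choose b ((π k ≡ᵇ k) ∧ (π (suc k) ≡ᵇ suc k))) (<⇒<ᵇ-true πk′<πk))

  act-fixed : π k ≡ k → π (suc k) ≡ suc k → act n k π ≡ s k ·ₚ π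
  act-fixed πk πk′ = trans act-unfold (cong₂ choose
    (trans (cong₂ _<ᵇ_ πk′ πk) (≤⇒<ᵇ-false (n≤1+n k)))
    (cong₂ _∧_ (trans (cong (_≡ᵇ k) πk) (≡ᵇ-refl k))
               (trans (cong (_≡ᵇ suc k) πk′) (≡ᵇ-refl (suc k)))))

  act-moved : π k < π (suc k) → ¬ (π k ≡ k × π (suc k) ≡ suc k) → act n k π ≡ (s k ·ₚ π) ·ₚ s k
  act-moved πk<πk′ not-fixed = trans act-unfold (cong₂ choose (≤⇒<ᵇ-false (<⇒≤ πk<πk′)) fixed-false)
    where
    fixed-false : ((π k ≡ᵇ k) ∧ (π (suc k) ≡ᵇ suc k)) ≡ false
    fixed-false with π k ≡ᵇ k in eq | π (suc k) ≡ᵇ suc k in eq′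
    ... | false | _     = refl
    ... | true  | false = refl
    ... | true  | true  = ⊥-elim (not-fixed (≡ᵇ-true⇒≡ eq , ≡ᵇ-true⇒≡ eq′))

involution-left-s-fixed : ∀ {n π k} → IsInvolution n π → π k ≡ k → π (suc k) ≡ suc k →
                          1 ≤ k → suc k ≤ n → IsInvolution n (s k ·ₚ π)
involution-left-s-fixed {n} {π} {k} π-inv πk πk′ 1≤k 1+k≤n = record
  { involutive = λ x → trans (cong (s k) (commutes (π x)))
                             (trans (s-involutive k (π (π x))) (involutive π-inv x))
  ; bounded    = λ 1≤x x≤n → let 1≤πx , πx≤n = bounded π-inv 1≤x x≤n
                             in s-bounded 1≤k 1+k≤n 1≤πx πx≤n
  }
  where
  commutes : ∀ y → π (s k y) ≡ s k (π y)
  commutes y with y ≟ k | y ≟ suc k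
  ... | yes refl | _        rewrite tr-fst y (suc y) | πk | πk′ = sym (tr-fst y (suc y))
  ... | no _     | yes refl rewrite tr-snd k (suc k) | πk | πk′ = sym (tr-snd k (suc k))
  ... | no y≢k   | no y≢1+k rewrite s-other y≢k y≢1+k =
    sym (s-other (y≢k ∘ injective π-inv ∘ flip trans (sym πk))
                 (y≢1+k ∘ injective π-inv ∘ flip trans (sym πk′)))

involution-conj-s : ∀ {n π k} → IsInvolution n π → 1 ≤ k → suc k ≤ n →
                    IsInvolution n ((s k ·ₚ π) ·ₚ s k)
involution-conj-s {n} {π} {k} π-inv 1≤k 1+k≤n = record
  { involutive = λ x → trans (cong (s k ∘ π) (s-involutive k (π (s k x))))
                             (trans (cong (s k) (involutive π-inv (s k x))) (s-involutive k x))
  ; bounded    = λ 1≤x x≤n →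
      let 1≤sx , sx≤n   = s-bounded 1≤k 1+k≤n 1≤x x≤n
          1≤πsx , πsx≤n = bounded π-inv 1≤sx sx≤n
      in s-bounded 1≤k 1+k≤n 1≤πsx πsx≤n
  }

twiceℓI : ℕ → Perm → ℕ
twiceℓI n π = inversions n π + exc n π

twiceℓI-left-s-fixed : ∀ {n π k} → IsInvolution n π → π k ≡ k → π (suc k) ≡ suc k →
                       1 ≤ k → suc k ≤ n → twiceℓI n (s k ·ₚ π) ≡ 2 + twiceℓI n π
twiceℓI-left-s-fixed {n} {π} {k} π-inv πk πk′ 1≤k 1+k≤n =
  trans (cong₂ _+_ (inversions-left-s n (injective π-inv) 1≤k (n<1+n k) 1+k≤n πk πk′)
                   (exc-left-s-fixed n k (injective π-inv) πk πk′ 1≤k 1+k≤n))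
        (cong suc (+-suc (inversions n π) (exc n π)))

twiceℓI-conj-s : ∀ {n π k} → IsInvolution n π → π k < π (suc k) → ¬ (π k ≡ k × π (suc k) ≡ suc k) →
                 1 ≤ k → suc k ≤ n → twiceℓI n ((s k ·ₚ π) ·ₚ s k) ≡ 2 + twiceℓI n π
twiceℓI-conj-s {n} {π} {k} π-inv πk<πk′ not-fixed 1≤k 1+k≤n =
  cong₂ _+_ (trans (inversions-left-s n π·s-injective 1≤p p<q q≤n πsp≡k πsq≡1+k)
                   (cong suc (inversions-right-s n π k 1≤k 1+k≤n πk<πk′)))
            (exc-conj-s n π k πk′≢k πk≢k′ 1≤k 1+k≤n)
  where
  ππ = involutive π-inv
  p = s k (π k)
  q = s k (π (suc k))
  π·s-injective : Injective _≡_ _≡_ (π ·ₚ s k)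
  π·s-injective {a} {b} eq =
    trans (sym (s-involutive k a)) (trans (cong (s k) (injective π-inv eq)) (s-involutive k b))
  1≤p : 1 ≤ p
  1≤p = let 1≤πk , πk≤n = bounded π-inv 1≤k (≤-trans (n≤1+n k) 1+k≤n)
        in proj₁ (s-bounded 1≤k 1+k≤n 1≤πk πk≤n)
  q≤n : q ≤ n
  q≤n = let 1≤πk′ , πk′≤n = bounded π-inv (s≤s z≤n) 1+k≤n
        in proj₂ (s-bounded 1≤k 1+k≤n 1≤πk′ πk′≤n)
  p<q : p < q
  p<q = s-mono-< k πk<πk′ not-fixed
  πsp≡k : π (s k p) ≡ k
  πsp≡k = trans (cong π (s-involutive k (π k))) (ππ k)
  πsq≡1+k : π (s k q) ≡ suc k
  πsq≡1+k = trans (cong π (s-involutive k (π (suc k)))) (ππ (suc k))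
  πk′≢k : π (suc k) ≢ k
  πk′≢k πk′≡k =
    <-asym πk<πk′ (subst₂ _<_ (sym πk′≡k) (trans (sym (ππ (suc k))) (cong π πk′≡k)) (n<1+n k))
  πk≢k′ : π k ≢ suc k
  πk≢k′ πk≡k′ =
    <-asym πk<πk′ (subst₂ _<_ (trans (sym (ππ k)) (cong π πk≡k′)) (sym πk≡k′) (n<1+n k))

-- Following the action of a word on the identity
record Tracks (n : ℕ) (π F : Perm) (q : ℕ) : Set where
  field
    involution : IsInvolution n π
    agrees     : π ≗ F
    weight     : twiceℓI n π ≡ q

open Tracks

tracks-e : ∀ n → Tracks n e e 0
tracks-e n = record
  { involution = record { involutive = λ _ → refl ; bounded = _,_ }
  ; agrees     = λ _ → refl
  ; weight     = cong₂ _+_ (inversions-e n) (exc-e n)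
  }

tracks-cong : ∀ {n π F G q} → Tracks n π F q → F ≗ G → Tracks n π G q
tracks-cong t F≗G = record
  { involution = involution t ; agrees = λ x → trans (agrees t x) (F≗G x) ; weight = weight t }

module _ {n π F q k} (t : Tracks n π F q) (1≤k : 1 ≤ k) (1+k≤n : suc k ≤ n) where
  open Action (involution t) 1≤k 1+k≤n

  tracks-descent : F (suc k) < F k → act n k π ≡ π
  tracks-descent Fk′<Fk = act-descent (subst₂ _<_ (sym (agrees t (suc k))) (sym (agrees t k)) Fk′<Fk)

  tracks-fixed : F k ≡ k → F (suc k) ≡ suc k → Tracks n (act n k π) (s k ·ₚ F) (2 + q)
  tracks-fixed Fk Fk′ = subst (λ σ → Tracks n σ (s k ·ₚ F) (2 + q)) (sym (act-fixed πk πk′)) record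
    { involution = involution-left-s-fixed (involution t) πk πk′ 1≤k 1+k≤n
    ; agrees     = λ x → cong (s k) (agrees t x)
    ; weight     = trans (twiceℓI-left-s-fixed (involution t) πk πk′ 1≤k 1+k≤n) (cong (2 +_) (weight t))
    }
    where
    πk : π k ≡ k
    πk = trans (agrees t k) Fk
    πk′ : π (suc k) ≡ suc k
    πk′ = trans (agrees t (suc k)) Fk′

  tracks-moved : F k < F (suc k) → ¬ (F k ≡ k × F (suc k) ≡ suc k) →
                 Tracks n (act n k π) ((s k ·ₚ F) ·ₚ s k) (2 + q)
  tracks-moved Fk<Fk′ not-fixed =
    subst (λ σ → Tracks n σ ((s k ·ₚ F) ·ₚ s k) (2 + q)) (sym (act-moved πk<πk′ not-fixed′)) record
    { involution = involution-conj-s (involution t) 1≤k 1+k≤n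
    ; agrees     = λ x → cong (s k) (agrees t (s k x))
    ; weight     = trans (twiceℓI-conj-s (involution t) πk<πk′ not-fixed′ 1≤k 1+k≤n) (cong (2 +_) (weight t))
    }
    where
    πk<πk′ : π k < π (suc k)
    πk<πk′ = subst₂ _<_ (sym (agrees t k)) (sym (agrees t (suc k))) Fk<Fk′
    not-fixed′ : ¬ (π k ≡ k × π (suc k) ≡ suc k)
    not-fixed′ (πk , πk′) = not-fixed (trans (sym (agrees t k)) πk , trans (sym (agrees t (suc k))) πk′)

tracks-asc : ∀ n m k → 1 ≤ k → k + m ≤ n → Tracks n (actWord n (asc k m) e) (tr k (k + m)) (m + m)
tracks-asc n zero k _ _ =
  tracks-cong (tracks-e n) (λ x → trans (sym (tr-diag k x)) (cong (λ z → tr k z x) (sym (+-identityʳ k))))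
tracks-asc n (suc zero) k 1≤k k+1≤n =
  tracks-cong (tracks-fixed (tracks-e n) 1≤k 1+k≤n refl refl) (λ x → cong (λ z → tr k z x) (+-comm 1 k))
  where
  1+k≤n = subst (_≤ n) (+-comm k 1) k+1≤n
tracks-asc n (suc (suc m)) k 1≤k k+2+m≤n =
  tracks-cong′ (tracks-moved (tracks-asc n (suc m) (suc k) (s≤s z≤n) 1+k+1+m≤n) 1≤k 1+k≤n Fk<Fk′ not-fixed)
  where
  1+k+1+m≤n : suc k + suc m ≤ n
  1+k+1+m≤n = subst (_≤ n) (+-suc k (suc m)) k+2+m≤n
  1+k≤n : suc k ≤ n
  1+k≤n = ≤-trans (m≤m+n (suc k) (suc m)) 1+k+1+m≤n
  F = tr (suc k) (suc k + suc m)
  k<1+k+1+m : k < suc k + suc m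
  k<1+k+1+m = s≤s (m≤m+n k (suc m))
  Fk≡k : F k ≡ k
  Fk≡k = tr-other (<⇒≢ (n<1+n k)) (<⇒≢ k<1+k+1+m)
  Fk<Fk′ : F k < F (suc k)
  Fk<Fk′ = subst₂ _<_ (sym Fk≡k) (sym (tr-fst (suc k) (suc k + suc m))) k<1+k+1+m
  not-fixed : ¬ (F k ≡ k × F (suc k) ≡ suc k)
  not-fixed (_ , Fk′≡k′) = <⇒≢ (m<m+n (suc k) (s≤s z≤n))
                               (sym (trans (sym (tr-fst (suc k) (suc k + suc m))) Fk′≡k′))
  tracks-cong′ : Tracks n _ ((s k ·ₚ F) ·ₚ s k) (2 + (suc m + suc m)) →
                 Tracks n _ (tr k (k + suc (suc m))) (suc (suc m) + suc (suc m))
  tracks-cong′ t = subst (Tracks n _ _) (cong suc (sym (+-suc (suc m) (suc m))))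
    (tracks-cong t (λ x → trans (tr-conj-s k (suc k) (suc k + suc m) x)
                                (cong₂ (λ u v → tr u v x) (tr-snd k (suc k))
                                       (trans (s-above (m<m+n (suc k) (s≤s z≤n))) (sym (+-suc k (suc m)))))))

_∉[_,_] : ℕ → ℕ → ℕ → Set
x ∉[ lo , hi ] = x < lo ⊎ hi < x

∉[]⇒≢ : ∀ {x lo hi y} → x ∉[ lo , hi ] → lo ≤ y → y ≤ hi → y ≢ x
∉[]⇒≢ (inj₁ x<lo) lo≤y _    refl = <⇒≱ x<lo lo≤y
∉[]⇒≢ (inj₂ hi<x) _    y≤hi refl = <⇒≱ hi<x y≤hi

∉[]-narrow : ∀ {x lo hi lo′ hi′} → lo ≤ lo′ → hi′ ≤ hi → x ∉[ lo , hi ] → x ∉[ lo′ , hi′ ]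
∉[]-narrow lo≤lo′ _      (inj₁ x<lo) = inj₁ (<-≤-trans x<lo lo≤lo′)
∉[]-narrow _      hi′≤hi (inj₂ hi<x) = inj₂ (≤-<-trans hi′≤hi hi<x)

-- the action of s_{d+m-1} ⋯ s_{d+1} s_d; its letter s_d acts first
actDesc : ℕ → ℕ → ℕ → Perm → Perm
actDesc n d m π = foldl (flip (act n)) π (asc d m)

tracks-push-step : ∀ {n π a b c d q} → Tracks n π (tr₂ c d a b) q → 1 ≤ c → c ≤ d → suc d ≤ n →
                   a ∉[ d , suc d ] → b ∉[ d , suc d ] → Tracks n (act n d π) (tr₂ c (suc d) a b) (2 + q)
tracks-push-step {n} {π} {a} {b} {c} {d} {q} t 1≤c c≤d 1+d≤n a∉ b∉ = step (c ≟ d)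
  where
  F = tr₂ c d a b
  d≢a : d ≢ a
  d≢a = ∉[]⇒≢ a∉ ≤-refl (n≤1+n d)
  d≢b : d ≢ b
  d≢b = ∉[]⇒≢ b∉ ≤-refl (n≤1+n d)
  d′≢a : suc d ≢ a
  d′≢a = ∉[]⇒≢ a∉ (n≤1+n d) ≤-refl
  d′≢b : suc d ≢ b
  d′≢b = ∉[]⇒≢ b∉ (n≤1+n d) ≤-refl
  Fd≡c : F d ≡ c
  Fd≡c = trans (cong (tr c d) (tr-other d≢a d≢b)) (tr-snd c d)
  Fd′≡d′ : F (suc d) ≡ suc d
  Fd′≡d′ = trans (cong (tr c d) (tr-other d′≢a d′≢b)) (tr-other (>⇒≢ (s≤s c≤d)) (>⇒≢ (n<1+n d)))
  step : Dec (c ≡ d) → Tracks n (act n d π) (tr₂ c (suc d) a b) (2 + q)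
  step (yes c≡d) = tracks-cong (tracks-fixed t (≤-trans 1≤c c≤d) 1+d≤n (trans Fd≡c c≡d) Fd′≡d′) fixed
    where
    fixed : ∀ x → s d (F x) ≡ tr₂ c (suc d) a b x
    fixed x rewrite c≡d = cong (s d) (tr-diag d (tr a b x))
  step (no c≢d) = tracks-cong (tracks-moved t (≤-trans 1≤c c≤d) 1+d≤n Fd<Fd′ not-fixed) conj
    where
    Fd<Fd′ : F d < F (suc d)
    Fd<Fd′ = subst₂ _<_ (sym Fd≡c) (sym Fd′≡d′) (s≤s c≤d)
    not-fixed : ¬ (F d ≡ d × F (suc d) ≡ suc d)
    not-fixed (Fd≡d , _) = c≢d (trans (sym Fd≡c) Fd≡d)
    conj : ∀ x → s d (F (s d x)) ≡ tr₂ c (suc d) a b x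
    conj x = begin
      s d (F (s d x))                           ≡⟨ tr₂-conj-s d c d a b x ⟩
      tr (s d c) (s d d) (tr (s d a) (s d b) x) ≡⟨ cong₂ (λ u v → tr u v (tr (s d a) (s d b) x))
                                                          (s-below (≤∧≢⇒< c≤d c≢d)) (tr-fst d (suc d)) ⟩
      tr c (suc d) (tr (s d a) (s d b) x)       ≡⟨ cong (tr c (suc d)) (cong₂ (λ u v → tr u v x)
                                                     (s-other (d≢a ∘ sym) (d′≢a ∘ sym))
                                                     (s-other (d≢b ∘ sym) (d′≢b ∘ sym))) ⟩
      tr₂ c (suc d) a b x                       ∎
      where open ≡-Reasoning

-- When c = d, the first letter meets the fixed points d, d+1 (tr d d is the identity)
-- and opens the cycle (d, d+1).
tracks-push : ∀ m {n π a b c d q} → Tracks n π (tr₂ c d a b) q → 1 ≤ c → c ≤ d → d + m ≤ n →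
              a ∉[ d , d + m ] → b ∉[ d , d + m ] → Tracks n (actDesc n d m π) (tr₂ c (d + m) a b) (m + m + q)
tracks-push zero {d = d} t _ _ _ _ _ =
  tracks-cong t (λ x → cong (λ z → tr₂ _ z _ _ x) (sym (+-identityʳ d)))
tracks-push (suc m) {n} {π} {a} {b} {c} {d} {q} t 1≤c c≤d d+1+m≤n a∉ b∉ =
  subst (Tracks n _ _) (weight-eq m q) (tracks-cong pushed (λ x → cong (λ z → tr₂ c z a b x) (sym (+-suc d m))))
  where
  1+d+m≤d+1+m : suc d + m ≤ d + suc m
  1+d+m≤d+1+m = ≤-reflexive (sym (+-suc d m))
  1+d≤d+1+m : suc d ≤ d + suc m
  1+d≤d+1+m = ≤-trans (s≤s (m≤m+n d m)) 1+d+m≤d+1+m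
  step : Tracks n (act n d π) (tr₂ c (suc d) a b) (2 + q)
  step = tracks-push-step t 1≤c c≤d (≤-trans 1+d≤d+1+m d+1+m≤n)
           (∉[]-narrow ≤-refl 1+d≤d+1+m a∉) (∉[]-narrow ≤-refl 1+d≤d+1+m b∉)
  pushed : Tracks n (actDesc n d (suc m) π) (tr₂ c (suc d + m) a b) (m + m + (2 + q))
  pushed = tracks-push m step 1≤c (m≤n⇒m≤1+n c≤d) (≤-trans 1+d+m≤d+1+m d+1+m≤n)
             (∉[]-narrow (n≤1+n d) 1+d+m≤d+1+m a∉) (∉[]-narrow (n≤1+n d) 1+d+m≤d+1+m b∉)
  weight-eq : ∀ m q → m + m + (2 + q) ≡ suc m + suc m + q
  weight-eq = solve-∀

ℓI-tracks : ∀ {n π F l} → Tracks n π F (l + l) → ℓI n π ≡ l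
ℓI-tracks {l = l} t =
  trans (cong (_/ 2) (trans (weight t) (trans (cong (l +_) (sym (+-identityʳ l))) (*-comm 2 l))))
        (m*n/n≡m l 2)

actWord-descAsc : ∀ n d m ys → actWord n (reverse (asc d m) ++ ys) e ≡ actDesc n d m (actWord n ys e)
actWord-descAsc n d m ys =
  trans (foldr-++ (act n) e (reverse (asc d m)) ys) (reverse-foldr (act n) (actWord n ys e) (asc d m))

-- Lengths of the words
wordPerm-asc-below : ∀ k m {x} → x < k → wordPerm (asc k m) x ≡ x
wordPerm-asc-below k zero    x<k = refl
wordPerm-asc-below k (suc m) x<k =
  trans (cong (s k) (wordPerm-asc-below (suc k) m (m<n⇒m<1+n x<k))) (s-below x<k)

wordPerm-asc-above : ∀ k m {x} → k + m < x → wordPerm (asc k m) x ≡ x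
wordPerm-asc-above k zero    k+0<x = refl
wordPerm-asc-above k (suc m) {x} k+1+m<x =
  trans (cong (s k) (wordPerm-asc-above (suc k) m 1+k+m<x))
        (s-above (≤-<-trans (s≤s (m≤m+n k m)) 1+k+m<x))
  where
  1+k+m<x = subst (_< x) (+-suc k m) k+1+m<x

wordPerm-asc-top : ∀ k m → wordPerm (asc k m) (k + m) ≡ k
wordPerm-asc-top k zero    = +-identityʳ k
wordPerm-asc-top k (suc m) =
  trans (cong (s k ∘ wordPerm (asc (suc k) m)) (+-suc k m))
        (trans (cong (s k) (wordPerm-asc-top (suc k) m)) (tr-snd k (suc k)))

wordPerm-asc-shift : ∀ k m {x} → k ≤ x → x < k + m → wordPerm (asc k m) x ≡ suc x
wordPerm-asc-shift k zero    {x} k≤x x<k+0 = ⊥-elim (<⇒≱ (subst (x <_) (+-identityʳ k) x<k+0) k≤x)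
wordPerm-asc-shift k (suc m) {x} k≤x x<k+1+m with x ≟ k
... | yes refl = trans (cong (s x) (wordPerm-asc-below (suc x) m (n<1+n x))) (tr-fst x (suc x))
... | no x≢k   =
  trans (cong (s k) (wordPerm-asc-shift (suc k) m (≤∧≢⇒< k≤x (x≢k ∘ sym)) (subst (x <_) (+-suc k m) x<k+1+m)))
        (s-above (s≤s (≤∧≢⇒< k≤x (x≢k ∘ sym))))

s·-injective : ∀ k {w : Perm} → Injective _≡_ _≡_ w → Injective _≡_ _≡_ (s k ·ₚ w)
s·-injective k inj eq = inj (trans (sym (s-involutive k _)) (trans (cong (s k) eq) (s-involutive k _)))

wordPerm-injective : ∀ ks → Injective _≡_ _≡_ (wordPerm ks)
wordPerm-injective []       eq = eq
wordPerm-injective (k ∷ ks)    = s·-injective k (wordPerm-injective ks)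

inversions-wordPerm-asc : ∀ n k m → 1 ≤ k → k + m ≤ n → inversions n (wordPerm (asc k m)) ≡ m
inversions-wordPerm-asc n k zero    _   _       = inversions-e n
inversions-wordPerm-asc n k (suc m) 1≤k k+1+m≤n =
  trans (inversions-left-s n (wordPerm-injective (asc (suc k) m)) 1≤k (s≤s (m≤m+n k m)) 1+k+m≤n
                           (wordPerm-asc-below (suc k) m (n<1+n k)) (wordPerm-asc-top (suc k) m))
        (cong suc (inversions-wordPerm-asc n (suc k) m (s≤s z≤n) 1+k+m≤n))
  where
  1+k+m≤n = subst (_≤ n) (+-suc k m) k+1+m≤n

mulDesc : ℕ → ℕ → Perm → Perm
mulDesc t m w = foldl (λ u k → s k ·ₚ u) w (asc t m)

-- Each s_y meets y at p and y+1 to the right of p, so it adds one inversion.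
inversions-mulDesc : ∀ n m {w : Perm} {p t} → Injective _≡_ _≡_ w → 1 ≤ p → w p ≡ t →
                     (∀ y → t < y → y ≤ t + m → Σ[ q ∈ ℕ ] p < q × q ≤ n × w q ≡ y) →
                     inversions n (mulDesc t m w) ≡ m + inversions n w
inversions-mulDesc n zero    _   _   _  _        = refl
inversions-mulDesc n (suc m) {w} {p} {t} inj 1≤p wp≡t preimage
  with preimage (suc t) (n<1+n t) (m<m+n t (s≤s z≤n))
... | q , p<q , q≤n , wq≡1+t =
  trans (inversions-mulDesc n m (s·-injective t inj) 1≤p (trans (cong (s t) wp≡t) (tr-fst t (suc t))) preimage′)
        (trans (cong (m +_) (inversions-left-s n inj 1≤p p<q q≤n wp≡t wq≡1+t)) (+-suc m _))
  where
  preimage′ : ∀ y → suc t < y → y ≤ suc t + m → Σ[ q ∈ ℕ ] p < q × q ≤ n × s t (w q) ≡ y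
  preimage′ y 1+t<y y≤1+t+m =
    let q , p<q , q≤n , wq≡y = preimage y (<-trans (n<1+n t) 1+t<y) (subst (y ≤_) (sym (+-suc t m)) y≤1+t+m)
    in q , p<q , q≤n , trans (cong (s t) wq≡y) (s-above 1+t<y)

wordPerm-descAsc : ∀ d m ys → wordPerm (reverse (asc d m) ++ ys) ≡ mulDesc d m (wordPerm ys)
wordPerm-descAsc d m ys =
  trans (wordPerm-++ (reverse (asc d m))) (reverse-foldr (λ k u → s k ·ₚ u) (wordPerm ys) (asc d m))
  where
  wordPerm-++ : ∀ xs → wordPerm (xs ++ ys) ≡ foldr (λ k u → s k ·ₚ u) (wordPerm ys) xs
  wordPerm-++ []       = refl
  wordPerm-++ (x ∷ xs) = cong (s x ·ₚ_) (wordPerm-++ xs)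

wordPerm-asc-preimage : ∀ a {y} → 2 ≤ y → Σ[ q ∈ ℕ ] pred y ≤ q × q ≤ y × wordPerm (asc 1 a) q ≡ y
wordPerm-asc-preimage a {suc y} (s≤s 1≤y) with suc y ≤? suc a
... | yes 1+y≤1+a = y , ≤-refl , n≤1+n y , wordPerm-asc-shift 1 a 1≤y 1+y≤1+a
... | no 1+y≰1+a  = suc y , n≤1+n y , ≤-refl , wordPerm-asc-above 1 a (≰⇒> 1+y≰1+a)

inversions-descAsc : ∀ n d m a {p} → 1 ≤ p → p ≤ d → suc a ≤ n → d + m ≤ n →
                     wordPerm (asc 1 a) p ≡ d →
                     inversions n (wordPerm (reverse (asc d m) ++ asc 1 a)) ≡ m + a
inversions-descAsc n d m a {p} 1≤p p≤d 1+a≤n d+m≤n up≡d =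
  trans (cong (inversions n) (wordPerm-descAsc d m (asc 1 a)))
        (trans (inversions-mulDesc n m (wordPerm-injective (asc 1 a)) 1≤p up≡d preimage)
               (cong (m +_) (inversions-wordPerm-asc n 1 a ≤-refl 1+a≤n)))
  where
  preimage : ∀ y → d < y → y ≤ d + m → Σ[ q ∈ ℕ ] p < q × q ≤ n × wordPerm (asc 1 a) q ≡ y
  preimage y d<y y≤d+m =
    let q , y-1≤q , q≤y , uq≡y = wordPerm-asc-preimage a (≤-trans (s≤s 1≤p) (≤-trans (s≤s p≤d) d<y))
        p≤q = ≤-trans p≤d (≤-trans (pred-mono-≤ d<y) y-1≤q)
    in q , ≤∧≢⇒< p≤q (λ p≡q → <⇒≢ d<y (trans (sym up≡d)
                                             (trans (cong (wordPerm (asc 1 a)) p≡q) uq≡y)))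
         , ≤-trans q≤y (≤-trans y≤d+m d+m≤n) , uq≡y

asc-++ : ∀ d a b → asc d (a + b) ≡ asc d a ++ asc (d + a) b
asc-++ d zero    b = cong (λ d′ → asc d′ b) (sym (+-identityʳ d))
asc-++ d (suc a) b =
  cong (d ∷_) (trans (asc-++ (suc d) a b) (cong (λ d′ → asc (suc d) a ++ asc d′ b) (sym (+-suc d a))))

descAsc-adjacent : ∀ {n j m v} → 1 ≤ j → suc j + m ≡ n → v ≡ reverse (asc (suc j) m) ++ asc 1 j →
                   (actWord n v e ≈[ n ] tr 1 n) × (ℓI n (actWord n v e) ≡ inversions n (wordPerm v))
descAsc-adjacent {j = j} {m} 1≤j refl refl =
  (λ x _ _ → trans (cong (λ π → π x) split) (trans (agrees pushed x) (cong (tr 1 n) (tr-diag 1 x)))) ,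
  trans (cong (ℓI n) split) (trans (ℓI-tracks (subst (Tracks n _ _) (interchange m m j j) pushed)) (sym length))
  where
  n = suc j + m
  split : actWord n (reverse (asc (suc j) m) ++ asc 1 j) e ≡ actDesc n (suc j) m (actWord n (asc 1 j) e)
  split = actWord-descAsc n (suc j) m (asc 1 j)
  start : Tracks n (actWord n (asc 1 j) e) (tr₂ 1 (suc j) 1 1) (j + j)
  start = tracks-cong (tracks-asc n j 1 ≤-refl (m≤m+n (suc j) m))
                      (λ x → cong (tr 1 (suc j)) (sym (tr-diag 1 x)))
  pushed : Tracks n (actDesc n (suc j) m (actWord n (asc 1 j) e)) (tr₂ 1 n 1 1) (m + m + (j + j))
  pushed = tracks-push m start ≤-refl (s≤s z≤n) ≤-refl (inj₁ (s≤s 1≤j)) (inj₁ (s≤s 1≤j))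
  length : inversions n (wordPerm (reverse (asc (suc j) m) ++ asc 1 j)) ≡ m + j
  length = inversions-descAsc n (suc j) m j 1≤j (n≤1+n j) (m≤m+n (suc j) m) ≤-refl
                              (wordPerm-asc-shift 1 j 1≤j (n<1+n j))

descAsc-apart : ∀ {n j r t v} → 1 ≤ j → suc (suc j + r) + t ≡ n →
                v ≡ reverse (asc (suc j) (r + suc t)) ++ asc 1 (suc j + r) →
                (actWord n v e ≈[ n ] tr₂ 1 n (suc j) (suc j + r))
                × (ℓI n (actWord n v e) + 1 ≡ inversions n (wordPerm v))
descAsc-apart {j = j} {r} {t} 1≤j refl refl =
  (λ x _ _ → trans (cong (λ π → π x) split) (agrees outer x)) ,
  trans (cong (λ π → ℓI n π + 1) split)
        (trans (cong (_+ 1) (ℓI-tracks (subst (Tracks n _ _) (weight-eq t r k) outer)))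
               (trans (length-eq t r k) (sym length)))
  where
  k = suc j + r
  i = suc k
  n = i + t
  1≢1+j : 1 ≢ suc j
  1≢1+j = <⇒≢ (s≤s 1≤j)
  1+j<i : suc j < i
  1+j<i = s≤s (s≤s (m≤m+n j r))
  1<k : 1 < k
  1<k = s≤s (≤-trans 1≤j (m≤m+n j r))
  π₀ = actWord n (asc 1 k) e
  start : Tracks n π₀ (tr₂ (suc j) (suc j) 1 i) (k + k)
  start = tracks-cong (tracks-asc n k 1 ≤-refl (m≤m+n i t)) (λ x → sym (tr-diag (suc j) (tr 1 i x)))
  π₁ = actDesc n (suc j) r π₀
  inner : Tracks n π₁ (tr₂ (suc j) k 1 i) (r + r + (k + k))
  inner = tracks-push r start (s≤s z≤n) ≤-refl (m≤n⇒m≤1+n (m≤m+n k t))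
                      (inj₁ (s≤s 1≤j)) (inj₂ (n<1+n k))
  -- the one descent: at this point 1 sits at i and j+1 at i-1
  descent : act n k π₁ ≡ π₁
  descent = tracks-descent inner (<⇒≤ 1<k) (m≤m+n i t) (subst₂ _<_
    (sym (trans (cong (tr (suc j) k) (tr-snd 1 i)) (tr-other 1≢1+j (<⇒≢ 1<k))))
    (sym (trans (cong (tr (suc j) k) (tr-other (>⇒≢ 1<k) (<⇒≢ (n<1+n k)))) (tr-snd (suc j) k)))
    (s≤s 1≤j))
  outer : Tracks n (actDesc n i t π₁) (tr₂ 1 n (suc j) k) (t + t + (r + r + (k + k)))
  outer = tracks-push t (tracks-cong inner (tr₂-comm 1≢1+j (<⇒≢ 1<k) (>⇒≢ 1+j<i) (>⇒≢ (n<1+n k))))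
                      ≤-refl (s≤s z≤n) ≤-refl (inj₁ 1+j<i) (inj₁ (n<1+n k))
  split : actWord n (reverse (asc (suc j) (r + suc t)) ++ asc 1 k) e ≡ actDesc n i t π₁
  split = trans (actWord-descAsc n (suc j) (r + suc t) (asc 1 k))
          (trans (cong (foldl (flip (act n)) π₀) (asc-++ (suc j) r (suc t)))
          (trans (foldl-++ (flip (act n)) π₀ (asc (suc j) r) (asc k (suc t)))
                 (cong (actDesc n i t) descent)))
  length : inversions n (wordPerm (reverse (asc (suc j) (r + suc t)) ++ asc 1 k)) ≡ r + suc t + k
  length = inversions-descAsc n (suc j) (r + suc t) k 1≤j (n≤1+n j) (m≤m+n i t)
             (≤-reflexive (last-letter j r t)) (wordPerm-asc-shift 1 k 1≤j (s≤s (m≤n⇒m≤1+n (m≤m+n j r))))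
    where
    last-letter : ∀ j r t → suc j + (r + suc t) ≡ suc (suc j + r) + t
    last-letter = solve-∀
  weight-eq : ∀ t r k → t + t + (r + r + (k + k)) ≡ (t + r + k) + (t + r + k)
  weight-eq = solve-∀
  length-eq : ∀ t r k → t + r + k + 1 ≡ r + suc t + k
  length-eq = solve-∀

descAsc-separated : ∀ {n j m a v} → suc a < j → j + m ≡ n → v ≡ reverse (asc j m) ++ asc 1 a →
                    (actWord n v e ≈[ n ] tr₂ 1 (suc a) j n) × (ℓI n (actWord n v e) ≡ inversions n (wordPerm v))
descAsc-separated {j = j} {m} {a} i<j refl refl =
  (λ x _ _ → trans (cong (λ π → π x) split)
                   (trans (agrees pushed x) (tr₂-comm (<⇒≢ 1<j) (<⇒≢ 1<n) (<⇒≢ i<j) (<⇒≢ i<n) x))) ,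
  trans (cong (ℓI n) split) (trans (ℓI-tracks (subst (Tracks n _ _) (interchange m m a a) pushed)) (sym length))
  where
  n = j + m
  i = suc a
  1<j : 1 < j
  1<j = ≤-<-trans (s≤s z≤n) i<j
  i<n : i < n
  i<n = <-≤-trans i<j (m≤m+n j m)
  1<n : 1 < n
  1<n = <-≤-trans 1<j (m≤m+n j m)
  split : actWord n (reverse (asc j m) ++ asc 1 a) e ≡ actDesc n j m (actWord n (asc 1 a) e)
  split = actWord-descAsc n j m (asc 1 a)
  start : Tracks n (actWord n (asc 1 a) e) (tr₂ j j 1 i) (a + a)
  start = tracks-cong (tracks-asc n a 1 ≤-refl (<⇒≤ i<n)) (λ x → sym (tr-diag j (tr 1 i x)))
  pushed : Tracks n (actDesc n j m (actWord n (asc 1 a) e)) (tr₂ j n 1 i) (m + m + (a + a))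
  pushed = tracks-push m start (<⇒≤ 1<j) ≤-refl ≤-refl (inj₁ 1<j) (inj₁ i<j)
  length : inversions n (wordPerm (reverse (asc j m) ++ asc 1 a)) ≡ m + a
  length = inversions-descAsc n j m a (<⇒≤ 1<j) ≤-refl (<⇒≤ i<n) ≤-refl (wordPerm-asc-above 1 a i<j)

vWord₁-≡ : ∀ {n i j m a} → suc j + m ≡ n → suc a ≡ i → vWord₁ n i j ≡ reverse (asc (suc j) m) ++ asc 1 a
vWord₁-≡ {j = j} {m} {a} refl refl = cong (λ m′ → reverse (asc (suc j) m′) ++ asc 1 a) (m+n∸m≡n j m)

vWord₂-≡ : ∀ {n i j m a} → 1 ≤ j → j + m ≡ n → suc a ≡ i →
           vWord₂ n i j ≡ reverse (asc j m) ++ asc 1 a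
vWord₂-≡ {j = suc j} {m} {a} _ refl refl = cong (λ m′ → reverse (asc (suc j) m′) ++ asc 1 a) (m+n∸m≡n j m)

part1-adjacent : ∀ {n i j} → 1 ≤ j → i ≡ j + 1 → i ≤ n →
                 (actWord n (vWord₁ n i j) e ≈[ n ] tr 1 n)
                 × (ℓI n (actWord n (vWord₁ n i j) e) ≡ inversions n (wordPerm (vWord₁ n i j)))
part1-adjacent {n} {j = j} 1≤j refl i≤n with m≤n⇒∃[o]m+o≡n (subst (_≤ n) (+-comm j 1) i≤n)
... | m , 1+j+m≡n =
  descAsc-adjacent {n} {j} {m} 1≤j 1+j+m≡n (vWord₁-≡ {n} {j + 1} {j} {m} {j} 1+j+m≡n (+-comm 1 j))

part1-nonadjacent : ∀ {n i j} → 1 ≤ j → 2 + j ≤ i → i ≤ n →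
              (actWord n (vWord₁ n i j) e ≈[ n ] tr₂ 1 n (suc j) (i ∸ 1))
              × (ℓI n (actWord n (vWord₁ n i j) e) + 1 ≡ inversions n (wordPerm (vWord₁ n i j)))
part1-nonadjacent {j = j} 1≤j 2+j≤i i≤n with m≤n⇒∃[o]m+o≡n 2+j≤i | m≤n⇒∃[o]m+o≡n i≤n
... | r , refl | t , refl =
  descAsc-apart {j = j} {r} {t} 1≤j refl
    (vWord₁-≡ {m = r + suc t} {a = suc j + r}
              (cong suc (trans (sym (+-assoc j r (suc t))) (+-suc (j + r) t))) refl)

part1-two-apart : ∀ {n i j} → 1 ≤ j → i ≡ j + 2 → i ≤ n →
                  (actWord n (vWord₁ n i j) e ≈[ n ] tr 1 n)
                  × (ℓI n (actWord n (vWord₁ n i j) e) + 1 ≡ inversions n (wordPerm (vWord₁ n i j)))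
part1-two-apart {n} {j = j} 1≤j refl i≤n =
  map₁ (λ v·e≈ x 1≤x x≤n → trans (v·e≈ x 1≤x x≤n)
                                 (cong (tr 1 n) (trans (cong (λ c → tr (suc j) c x) (cong (_∸ 1) (+-comm j 2)))
                                                       (tr-diag (suc j) x))))
       (part1-nonadjacent 1≤j (≤-reflexive (+-comm 2 j)) i≤n)

part1-far-apart : ∀ {n i j} → 1 ≤ j → j + 2 < i → i ≤ n →
                  (actWord n (vWord₁ n i j) e ≈[ n ] (tr 1 n ·ₚ tr (j + 1) (i ∸ 1)))
                  × (ℓI n (actWord n (vWord₁ n i j) e) + 1 ≡ inversions n (wordPerm (vWord₁ n i j)))
part1-far-apart {n} {i} {j} 1≤j j+2<i i≤n =
  map₁ (λ v·e≈ x 1≤x x≤n → trans (v·e≈ x 1≤x x≤n)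
                                 (cong (λ c → tr 1 n (tr c (i ∸ 1) x)) (+-comm 1 j)))
       (part1-nonadjacent 1≤j (<⇒≤ (subst (_< i) (+-comm j 2) j+2<i)) i≤n)

part2 : ∀ {n i j} → 1 ≤ i → i < j → j ≤ n →
        (actWord n (vWord₂ n i j) e ≈[ n ] (tr 1 i ·ₚ tr j n))
        × (ℓI n (actWord n (vWord₂ n i j) e) ≡ inversions n (wordPerm (vWord₂ n i j)))
part2 {n} {suc a} {j} _ i<j j≤n with m≤n⇒∃[o]m+o≡n j≤n
... | m , j+m≡n =
  descAsc-separated {n} {j} {m} {a} i<j j+m≡n
    (vWord₂-≡ {n} {suc a} {j} {m} {a} (≤-trans (s≤s z≤n) i<j) j+m≡n refl)

lemma3p8 : (n : ℕ) → 1 ≤ n →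
    ((i j : ℕ) → 1 ≤ j → j < i → i ≤ n →
      ((i ≡ j + 1 →
          (actWord n (vWord₁ n i j) e ≈[ n ] tr 1 n)
          × (ℓI n (actWord n (vWord₁ n i j) e) ≡ inversions n (wordPerm (vWord₁ n i j))))
      × (i ≡ j + 2 →
          (actWord n (vWord₁ n i j) e ≈[ n ] tr 1 n)
          × (ℓI n (actWord n (vWord₁ n i j) e) + 1 ≡ inversions n (wordPerm (vWord₁ n i j))))
      × (j + 2 < i →
          (actWord n (vWord₁ n i j) e ≈[ n ] (tr 1 n ·ₚ tr (j + 1) (i ∸ 1)))
          × (ℓI n (actWord n (vWord₁ n i j) e) + 1 ≡ inversions n (wordPerm (vWord₁ n i j))))))
    × ((i j : ℕ) → 1 ≤ i → i < j → j ≤ n →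
          (actWord n (vWord₂ n i j) e ≈[ n ] (tr 1 i ·ₚ tr j n))
          × (ℓI n (actWord n (vWord₂ n i j) e) ≡ inversions n (wordPerm (vWord₂ n i j))))
-- The hypothesis 1 ≤ n follows from the others.
lemma3p8 n _ =
  (λ i j 1≤j _ i≤n → (λ i≡j+1 → part1-adjacent 1≤j i≡j+1 i≤n) ,
                     (λ i≡j+2 → part1-two-apart 1≤j i≡j+2 i≤n) ,
                     (λ j+2<i → part1-far-apart 1≤j j+2<i i≤n)) ,
  λ _ _ → part2
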